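{- Let $a_0 = 0$ and, for every positive integer $n$, $a_n := \sum_{k=0}^{n-1} k!\,(n-k-1)!$. Then for every natural number $n$, $$a_n = (-1)^{n-1} \sum_{k=0}^{n} G_k\, s(n,k).$$
   Context: The Genocchi numbers $G_n$ ($n \geq 0$) are defined by $\frac{2x}{e^x+1} = \sum_{n=0}^{\infty} G_n \frac{x^n}{n!}$. The (signed) Stirling numbers of the first kind $s(n,k)$ ($0 \leq k \leq n$) are the integers defined by $X(X-1)\cdots(X-n+1) = \sum_{k=0}^{n} s(n,k) X^k$. -}

module Defs where

open import Data.Nat as ℕ using (ℕ; zero; suc; _!)
open import Data.Nat.Combinatorics using (_C_)
open import Data.Integer as ℤ using (ℤ; +_)
open import Data.List using (List; []; _∷_)
open import Data.Rational as ℚ using (ℚ; 0ℚ; 1ℚ)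

sumℕ : ℕ → (ℕ → ℕ) → ℕ
sumℕ zero    f = 0
sumℕ (suc n) f = sumℕ n f ℕ.+ f n

sumℚ : ℕ → (ℕ → ℚ) → ℚ
sumℚ zero    f = 0ℚ
sumℚ (suc n) f = sumℚ n f ℚ.+ f n

ℤtoℚ : ℤ → ℚ
ℤtoℚ z = z ℚ./ 1

ℕtoℚ : ℕ → ℚ
ℕtoℚ n = ℤtoℚ (+ n)

-- Genocchi numbers: 2x/(e^x+1) = Σ G_n x^n/n!, i.e. (e^x + 1) Σ G_n x^n/n! = 2x.
-- Comparing coefficients of x^n/n!:  Σ_{k=0}^{n} C(n,k) G_k + G_n = 2·[n = 1].
-- Since 2 is invertible in ℚ this determines G uniquely.
twoIfOne : ℕ → ℚ
twoIfOne 1 = ℕtoℚ 2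
twoIfOne _ = 0ℚ

IsGenocchi : (ℕ → ℚ) → Set
IsGenocchi G = ∀ n →
  sumℚ (suc n) (λ k → ℕtoℚ (n C k) ℚ.* G k) ℚ.+ G n ≡ twoIfOne n
  where open import Relation.Binary.PropositionalEquality using (_≡_)

-- Polynomials over ℤ as coefficient lists (constant term first).
Poly : Set
Poly = List ℤ

shiftX : Poly → Poly
shiftX p = + 0 ∷ p

scale : ℤ → Poly → Poly
scale c []       = []
scale c (a ∷ p)  = c ℤ.* a ∷ scale c p

addP : Poly → Poly → Poly
addP []      q       = q
addP p       []      = p
addP (a ∷ p) (b ∷ q) = a ℤ.+ b ∷ addP p q

mulXminus : ℤ → Poly → Poly
mulXminus c p = addP (shiftX p) (scale (ℤ.- c) p)

fallingFactorial : ℕ → Poly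
fallingFactorial zero    = + 1 ∷ []
fallingFactorial (suc n) = mulXminus (+ n) (fallingFactorial n)

coeff : Poly → ℕ → ℤ
coeff []      _       = + 0
coeff (a ∷ p) zero    = a
coeff (a ∷ p) (suc k) = coeff p k

stirling1 : ℕ → ℕ → ℤ
stirling1 n k = coeff (fallingFactorial n) k

a : ℕ → ℕ
a zero    = 0
a (suc m) = sumℕ (suc m) (λ k → (k !) ℕ.* ((m ℕ.∸ k) !))

-- (-1)^(n-1) as an integer exponent: n = 0 gives (-1)^(-1) = -1
signPred : ℕ → ℚ
signPred zero    = ℚ.- 1ℚ
signPred (suc m) = ℤtoℚ ((ℤ.- (+ 1)) ℤ.^ m)

-- Write cₙ = Σₖ Gₖ s(n, k). Multiplying the Genocchi relation Σⱼ C(k, j) Gⱼ + Gₖ = 2 [k = 1] by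
-- s(n + 1, k) and summing over k, the binomial sums recombine into
-- Σₖ C(k, j) s(n + 1, k) = s(n + 1, j) + (n + 1) s(n, j), the coefficients of the falling factorial
-- (X + 1) X ⋯ (X - n + 1) = (X + 1) · (X)ₙ. This gives 2 cₙ₊₁ + (n + 1) cₙ = 2 s(n + 1, 1) = 2 (-1)ⁿ n!.
-- Splitting off the first or the last term of aₙ₊₁ gives 2 aₙ₊₁ = (n + 1) aₙ + 2 n!, so aₙ and
-- (-1)ⁿ⁻¹ cₙ satisfy the same recurrence, and both vanish at n = 0 because G₀ = 0.
module Submission where

open import Defs
open import Data.Nat as ℕ using (ℕ; zero; suc; _<_; _≤_; _∸_; _!)
import Data.Nat.Properties as ℕP
open import Data.Nat.Tactic.RingSolver using (solve-∀)
open import Data.Nat.Combinatorics using (_C_; nCk+nC[k+1]≡[n+1]C[k+1]; k>n⇒nCk≡0)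
open import Data.Integer as ℤ using (+_)
import Data.Integer.Properties as ℤP
open import Data.Rational as ℚ using (ℚ; 0ℚ; 1ℚ; ½; _+_; _*_; -_; toℚᵘ)
import Data.Rational.Properties as ℚP
import Data.Rational.Unnormalised as ℚᵘ
import Data.Rational.Unnormalised.Properties as ℚᵘP
open import Data.Rational.Solver using (module +-*-Solver)
open import Data.List using ([]; _∷_)
open import Function using (_∘_)
open import Relation.Binary.PropositionalEquality

open +-*-Solver using (solve; _:=_; _:+_; _:*_; :-_; con)

toℚᵘ-ℤtoℚ : ∀ z → toℚᵘ (ℤtoℚ z) ℚᵘ.≃ ℚᵘ.mkℚᵘ z 0
toℚᵘ-ℤtoℚ z = ℚP.toℚᵘ-fromℚᵘ (ℚᵘ.mkℚᵘ z 0)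

ℤtoℚ-homo-+ : ∀ x y → ℤtoℚ (x ℤ.+ y) ≡ ℤtoℚ x + ℤtoℚ y
ℤtoℚ-homo-+ x y = ℚP.toℚᵘ-injective (begin
  toℚᵘ (ℤtoℚ (x ℤ.+ y))             ≈⟨ toℚᵘ-ℤtoℚ (x ℤ.+ y) ⟩
  ℚᵘ.mkℚᵘ (x ℤ.+ y) 0               ≈⟨ ℚᵘ.*≡* (cong (ℤ._* + 1)
                                          (sym (cong₂ ℤ._+_ (ℤP.*-identityʳ x) (ℤP.*-identityʳ y)))) ⟩
  ℚᵘ.mkℚᵘ x 0 ℚᵘ.+ ℚᵘ.mkℚᵘ y 0      ≈⟨ ℚᵘP.+-cong (toℚᵘ-ℤtoℚ x) (toℚᵘ-ℤtoℚ y) ⟨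
  toℚᵘ (ℤtoℚ x) ℚᵘ.+ toℚᵘ (ℤtoℚ y)  ≈⟨ ℚP.toℚᵘ-homo-+ (ℤtoℚ x) (ℤtoℚ y) ⟨
  toℚᵘ (ℤtoℚ x + ℤtoℚ y)            ∎)
  where open ℚᵘP.≃-Reasoning

ℤtoℚ-homo-* : ∀ x y → ℤtoℚ (x ℤ.* y) ≡ ℤtoℚ x * ℤtoℚ y
ℤtoℚ-homo-* x y = ℚP.toℚᵘ-injective (begin
  toℚᵘ (ℤtoℚ (x ℤ.* y))             ≈⟨ toℚᵘ-ℤtoℚ (x ℤ.* y) ⟩
  ℚᵘ.mkℚᵘ x 0 ℚᵘ.* ℚᵘ.mkℚᵘ y 0      ≈⟨ ℚᵘP.*-cong (toℚᵘ-ℤtoℚ x) (toℚᵘ-ℤtoℚ y) ⟨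
  toℚᵘ (ℤtoℚ x) ℚᵘ.* toℚᵘ (ℤtoℚ y)  ≈⟨ ℚP.toℚᵘ-homo-* (ℤtoℚ x) (ℤtoℚ y) ⟨
  toℚᵘ (ℤtoℚ x * ℤtoℚ y)            ∎)
  where open ℚᵘP.≃-Reasoning

ℤtoℚ-homo‿- : ∀ x → ℤtoℚ (ℤ.- x) ≡ - ℤtoℚ x
ℤtoℚ-homo‿- x = ℚP.toℚᵘ-injective (begin
  toℚᵘ (ℤtoℚ (ℤ.- x))     ≈⟨ toℚᵘ-ℤtoℚ (ℤ.- x) ⟩
  ℚᵘ.- ℚᵘ.mkℚᵘ x 0        ≈⟨ ℚᵘP.-‿cong (toℚᵘ-ℤtoℚ x) ⟨
  ℚᵘ.- toℚᵘ (ℤtoℚ x)      ≈⟨ ℚP.toℚᵘ-homo‿- (ℤtoℚ x) ⟨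
  toℚᵘ (- ℤtoℚ x)         ∎)
  where open ℚᵘP.≃-Reasoning

ℕtoℚ-homo-+ : ∀ m n → ℕtoℚ (m ℕ.+ n) ≡ ℕtoℚ m + ℕtoℚ n
ℕtoℚ-homo-+ m n = trans (cong ℤtoℚ (ℤP.pos-+ m n)) (ℤtoℚ-homo-+ (+ m) (+ n))

ℕtoℚ-homo-* : ∀ m n → ℕtoℚ (m ℕ.* n) ≡ ℕtoℚ m * ℕtoℚ n
ℕtoℚ-homo-* m n = trans (cong ℤtoℚ (ℤP.pos-* m n)) (ℤtoℚ-homo-* (+ m) (+ n))

ℕtoℚ-sumℕ : ∀ n f → ℕtoℚ (sumℕ n f) ≡ sumℚ n (ℕtoℚ ∘ f)
ℕtoℚ-sumℕ zero    f = refl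
ℕtoℚ-sumℕ (suc n) f = trans (ℕtoℚ-homo-+ (sumℕ n f) (f n)) (cong (_+ ℕtoℚ (f n)) (ℕtoℚ-sumℕ n f))

double-injective : ∀ {x y} → x + x ≡ y + y → x ≡ y
double-injective {x} {y} x+x≡y+y = begin
  x              ≡⟨ half-double x ⟨
  ½ * (x + x)    ≡⟨ cong (½ *_) x+x≡y+y ⟩
  ½ * (y + y)    ≡⟨ half-double y ⟩
  y              ∎
  where
  open ≡-Reasoning
  half-double : ∀ z → ½ * (z + z) ≡ z
  half-double = solve 1 (λ z → con ½ :* (z :+ z) := z) refl

sumℚ-cong< : ∀ N {f g} → (∀ k → k < N → f k ≡ g k) → sumℚ N f ≡ sumℚ N g
sumℚ-cong< zero    f≡g = refl
sumℚ-cong< (suc N) f≡g =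
  cong₂ _+_ (sumℚ-cong< N (λ k k<N → f≡g k (ℕP.m<n⇒m<1+n k<N))) (f≡g N ℕP.≤-refl)

sumℚ-cong : ∀ N {f g} → (∀ k → f k ≡ g k) → sumℚ N f ≡ sumℚ N g
sumℚ-cong N f≡g = sumℚ-cong< N (λ k _ → f≡g k)

sumℚ-zero : ∀ N {f} → (∀ k → k < N → f k ≡ 0ℚ) → sumℚ N f ≡ 0ℚ
sumℚ-zero zero    f≡0 = refl
sumℚ-zero (suc N) f≡0 = trans
  (cong₂ _+_ (sumℚ-zero N (λ k k<N → f≡0 k (ℕP.m<n⇒m<1+n k<N))) (f≡0 N ℕP.≤-refl))
  (ℚP.+-identityʳ 0ℚ)

sumℚ-suc-last-zero : ∀ N {f} → f N ≡ 0ℚ → sumℚ (suc N) f ≡ sumℚ N f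
sumℚ-suc-last-zero N {f} fN≡0 = trans (cong (_+_ (sumℚ N f)) fN≡0) (ℚP.+-identityʳ (sumℚ N f))

sumℚ-extend : ∀ N m {f} → (∀ k → N ≤ k → f k ≡ 0ℚ) → sumℚ (m ℕ.+ N) f ≡ sumℚ N f
sumℚ-extend N zero    f≡0 = refl
sumℚ-extend N (suc m) f≡0 =
  trans (sumℚ-suc-last-zero (m ℕ.+ N) (f≡0 (m ℕ.+ N) (ℕP.m≤n+m N m))) (sumℚ-extend N m f≡0)

sumℚ-+ : ∀ N f g → sumℚ N (λ k → f k + g k) ≡ sumℚ N f + sumℚ N g
sumℚ-+ zero    f g = refl
sumℚ-+ (suc N) f g =
  trans (cong (_+ (f N + g N)) (sumℚ-+ N f g)) (interchange (sumℚ N f) (sumℚ N g) (f N) (g N))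
  where
  interchange : ∀ w x y z → (w + x) + (y + z) ≡ (w + y) + (x + z)
  interchange = solve 4 (λ w x y z → (w :+ x) :+ (y :+ z) := (w :+ y) :+ (x :+ z)) refl

sumℚ-*ˡ : ∀ N c f → sumℚ N (λ k → c * f k) ≡ c * sumℚ N f
sumℚ-*ˡ zero    c f = sym (ℚP.*-zeroʳ c)
sumℚ-*ˡ (suc N) c f =
  trans (cong (_+ (c * f N)) (sumℚ-*ˡ N c f)) (sym (ℚP.*-distribˡ-+ c (sumℚ N f) (f N)))

sumℚ-suc-head : ∀ N f → sumℚ (suc N) f ≡ f 0 + sumℚ N (f ∘ suc)
sumℚ-suc-head zero    f = ℚP.+-comm 0ℚ (f 0)
sumℚ-suc-head (suc N) f = trans (cong (_+ f (suc N)) (sumℚ-suc-head N f)) (ℚP.+-assoc (f 0) _ _)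

sumℚ-swap : ∀ N M (h : ℕ → ℕ → ℚ) →
  sumℚ N (λ k → sumℚ M (h k)) ≡ sumℚ M (λ j → sumℚ N (λ k → h k j))
sumℚ-swap zero    M h = sym (sumℚ-zero M (λ _ _ → refl))
sumℚ-swap (suc N) M h = trans (cong (_+ sumℚ M (h N)) (sumℚ-swap N M h))
  (sym (sumℚ-+ M (λ j → sumℚ N (λ k → h k j)) (h N)))

coeff-addP : ∀ p q k → coeff (addP p q) k ≡ coeff p k ℤ.+ coeff q k
coeff-addP []      q       k       = sym (ℤP.+-identityˡ _)
coeff-addP (x ∷ p) []      zero    = sym (ℤP.+-identityʳ _)
coeff-addP (x ∷ p) []      (suc k) = sym (ℤP.+-identityʳ _)
coeff-addP (x ∷ p) (y ∷ q) zero    = refl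
coeff-addP (x ∷ p) (y ∷ q) (suc k) = coeff-addP p q k

coeff-scale : ∀ c p k → coeff (scale c p) k ≡ c ℤ.* coeff p k
coeff-scale c []      k       = sym (ℤP.*-zeroʳ c)
coeff-scale c (x ∷ p) zero    = refl
coeff-scale c (x ∷ p) (suc k) = coeff-scale c p k

coeff-mulXminus : ∀ c p k → coeff (mulXminus c p) k ≡ coeff (shiftX p) k ℤ.+ (ℤ.- c) ℤ.* coeff p k
coeff-mulXminus c p k = trans (coeff-addP (shiftX p) (scale (ℤ.- c) p) k)
  (cong (λ u → coeff (shiftX p) k ℤ.+ u) (coeff-scale (ℤ.- c) p k))

stirling1-vanish : ∀ {n k} → n < k → stirling1 n k ≡ ℤ.0ℤ
stirling1-vanish {zero}  {suc k} _             = refl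
stirling1-vanish {suc n} {suc k} (ℕ.s≤s n<k) = begin
  stirling1 (suc n) (suc k)                            ≡⟨ coeff-mulXminus (+ n) (fallingFactorial n) (suc k) ⟩
  stirling1 n k ℤ.+ (ℤ.- + n) ℤ.* stirling1 n (suc k)  ≡⟨ cong₂ (λ u v → u ℤ.+ (ℤ.- + n) ℤ.* v)
                                                            (stirling1-vanish n<k) (stirling1-vanish (ℕP.m<n⇒m<1+n n<k)) ⟩
  ℤ.0ℤ ℤ.+ (ℤ.- + n) ℤ.* ℤ.0ℤ                          ≡⟨ cong (ℤ._+_ ℤ.0ℤ) (ℤP.*-zeroʳ (ℤ.- + n)) ⟩
  ℤ.0ℤ                                                 ∎
  where open ≡-Reasoning

stirling1-suc-zero : ∀ n → stirling1 (suc n) 0 ≡ ℤ.0ℤ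
stirling1-suc-zero zero    = refl
stirling1-suc-zero (suc n) = begin
  stirling1 (suc (suc n)) 0                       ≡⟨ coeff-mulXminus (+ suc n) (fallingFactorial (suc n)) 0 ⟩
  ℤ.0ℤ ℤ.+ (ℤ.- + suc n) ℤ.* stirling1 (suc n) 0  ≡⟨ cong (λ u → ℤ.0ℤ ℤ.+ (ℤ.- + suc n) ℤ.* u) (stirling1-suc-zero n) ⟩
  ℤ.0ℤ ℤ.+ (ℤ.- + suc n) ℤ.* ℤ.0ℤ                 ≡⟨ cong (ℤ._+_ ℤ.0ℤ) (ℤP.*-zeroʳ (ℤ.- + suc n)) ⟩
  ℤ.0ℤ                                            ∎
  where open ≡-Reasoning

s : ℕ → ℕ → ℚ
s n k = ℤtoℚ (stirling1 n k)

s-vanish : ∀ {n k} → n < k → s n k ≡ 0ℚ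
s-vanish n<k = cong ℤtoℚ (stirling1-vanish n<k)

shift : (ℕ → ℚ) → ℕ → ℚ
shift f zero    = 0ℚ
shift f (suc k) = f k

s-suc : ∀ n k → s (suc n) k ≡ shift (s n) k + (- ℕtoℚ n) * s n k
s-suc n k = begin
  s (suc n) k
    ≡⟨ cong ℤtoℚ (coeff-mulXminus (+ n) (fallingFactorial n) k) ⟩
  ℤtoℚ (Xsₙ ℤ.+ (ℤ.- + n) ℤ.* stirling1 n k)
    ≡⟨ ℤtoℚ-homo-+ Xsₙ ((ℤ.- + n) ℤ.* stirling1 n k) ⟩
  ℤtoℚ Xsₙ + ℤtoℚ ((ℤ.- + n) ℤ.* stirling1 n k)
    ≡⟨ cong (_+_ (ℤtoℚ Xsₙ)) (ℤtoℚ-homo-* (ℤ.- + n) (stirling1 n k)) ⟩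
  ℤtoℚ Xsₙ + ℤtoℚ (ℤ.- + n) * s n k
    ≡⟨ cong₂ (λ u v → u + v * s n k) (ℤtoℚ-shiftX k) (ℤtoℚ-homo‿- (+ n)) ⟩
  shift (s n) k + (- ℕtoℚ n) * s n k
    ∎
  where
  open ≡-Reasoning
  Xsₙ = coeff (shiftX (fallingFactorial n)) k
  ℤtoℚ-shiftX : ∀ k → ℤtoℚ (coeff (shiftX (fallingFactorial n)) k) ≡ shift (s n) k
  ℤtoℚ-shiftX zero    = refl
  ℤtoℚ-shiftX (suc k) = refl

-- If f lists the coefficients of a polynomial p of degree < M, then translate M f lists those of p (X + 1).
translate : ℕ → (ℕ → ℚ) → ℕ → ℚ
translate M f j = sumℚ M (λ k → ℕtoℚ (k C j) * f k)

translate-cong : ∀ M {f g} → (∀ k → f k ≡ g k) → ∀ j → translate M f j ≡ translate M g j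
translate-cong M f≡g j = sumℚ-cong M (λ k → cong (ℕtoℚ (k C j) *_) (f≡g k))

translate-linear : ∀ M f g c j → translate M (λ k → f k + c * g k) j ≡ translate M f j + c * translate M g j
translate-linear M f g c j = begin
  sumℚ M (λ k → ℕtoℚ (k C j) * (f k + c * g k))                 ≡⟨ sumℚ-cong M (λ k → distrib (ℕtoℚ (k C j)) (f k) c (g k)) ⟩
  sumℚ M (λ k → ℕtoℚ (k C j) * f k + c * (ℕtoℚ (k C j) * g k))  ≡⟨ sumℚ-+ M _ _ ⟩
  translate M f j + sumℚ M (λ k → c * (ℕtoℚ (k C j) * g k))     ≡⟨ cong (_+_ (translate M f j)) (sumℚ-*ˡ M c _) ⟩
  translate M f j + c * translate M g j                         ∎
  where
  open ≡-Reasoning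
  distrib : ∀ w x y z → w * (x + y * z) ≡ w * x + y * (w * z)
  distrib = solve 4 (λ w x y z → w :* (x :+ y :* z) := w :* x :+ y :* (w :* z)) refl

-- (X + 1) p(X + 1) = p(X + 1) + X p(X + 1), coefficientwise Pascal's rule.
translate-shift : ∀ M f j → translate (suc M) (shift f) j ≡ translate M f j + shift (translate M f) j
translate-shift M f j = begin
  translate (suc M) (shift f) j        ≡⟨ sumℚ-suc-head M (λ k → ℕtoℚ (k C j) * shift f k) ⟩
  ℕtoℚ (0 C j) * 0ℚ + S⁺       ≡⟨ cong (_+ S⁺) (ℚP.*-zeroʳ (ℕtoℚ (0 C j))) ⟩
  0ℚ + S⁺                      ≡⟨ ℚP.+-identityˡ S⁺ ⟩
  S⁺                           ≡⟨ pascal j ⟩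
  translate M f j + shift (translate M f) j  ∎
  where
  open ≡-Reasoning
  S⁺ = sumℚ M (λ k → ℕtoℚ (suc k C j) * f k)
  pascal : ∀ j → sumℚ M (λ k → ℕtoℚ (suc k C j) * f k) ≡ translate M f j + shift (translate M f) j
  pascal zero    = sym (ℚP.+-identityʳ _)
  pascal (suc j) = begin
    sumℚ M (λ k → ℕtoℚ (suc k C suc j) * f k)                    ≡⟨ sumℚ-cong M split ⟩
    sumℚ M (λ k → ℕtoℚ (k C j) * f k + ℕtoℚ (k C suc j) * f k)   ≡⟨ sumℚ-+ M _ _ ⟩
    translate M f j + translate M f (suc j)                      ≡⟨ ℚP.+-comm (translate M f j) (translate M f (suc j)) ⟩
    translate M f (suc j) + translate M f j                      ∎
    where
    split : ∀ k → ℕtoℚ (suc k C suc j) * f k ≡ ℕtoℚ (k C j) * f k + ℕtoℚ (k C suc j) * f k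
    split k = begin
      ℕtoℚ (suc k C suc j) * f k                   ≡⟨ cong (λ u → ℕtoℚ u * f k) (nCk+nC[k+1]≡[n+1]C[k+1] k j) ⟨
      ℕtoℚ (k C j ℕ.+ k C suc j) * f k             ≡⟨ cong (_* f k) (ℕtoℚ-homo-+ (k C j) (k C suc j)) ⟩
      (ℕtoℚ (k C j) + ℕtoℚ (k C suc j)) * f k      ≡⟨ ℚP.*-distribʳ-+ (f k) (ℕtoℚ (k C j)) (ℕtoℚ (k C suc j)) ⟩
      ℕtoℚ (k C j) * f k + ℕtoℚ (k C suc j) * f k  ∎

-- Coefficients of (X + 1) X (X - 1) ⋯ (X - n + 2), the falling factorial at X + 1.
translatedStirling : ℕ → ℕ → ℚ
translatedStirling n = translate (suc n) (s n)

translatedStirling-rec : ∀ n j → translatedStirling (suc n) j ≡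
  (translatedStirling n j + shift (translatedStirling n) j) + (- ℕtoℚ n) * translatedStirling n j
translatedStirling-rec n j = begin
  translate (2 ℕ.+ n) (s (suc n)) j
    ≡⟨ translate-cong (2 ℕ.+ n) (s-suc n) j ⟩
  translate (2 ℕ.+ n) (λ k → shift (s n) k + (- ℕtoℚ n) * s n k) j
    ≡⟨ translate-linear (2 ℕ.+ n) (shift (s n)) (s n) (- ℕtoℚ n) j ⟩
  translate (2 ℕ.+ n) (shift (s n)) j + (- ℕtoℚ n) * translate (2 ℕ.+ n) (s n) j
    ≡⟨ cong₂ (λ u v → u + (- ℕtoℚ n) * v) (translate-shift (suc n) (s n) j) drop-last ⟩
  (translatedStirling n j + shift (translatedStirling n) j) + (- ℕtoℚ n) * translatedStirling n j
    ∎
  where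
  open ≡-Reasoning
  drop-last : translate (2 ℕ.+ n) (s n) j ≡ translatedStirling n j
  drop-last = sumℚ-suc-last-zero (suc n)
    (trans (cong (ℕtoℚ (suc n C j) *_) (s-vanish {n} ℕP.≤-refl)) (ℚP.*-zeroʳ (ℕtoℚ (suc n C j))))

translatedStirling-suc : ∀ n j → translatedStirling (suc n) j ≡ s n j + shift (s n) j
translatedStirling-suc zero j = begin
  translatedStirling 1 j                                                     ≡⟨ translatedStirling-rec 0 j ⟩
  (translatedStirling 0 j + shift (translatedStirling 0) j) + (- 0ℚ) * translatedStirling 0 j
    ≡⟨ cong₂ (λ u v → (u + v) + (- 0ℚ) * u) (base j) (shift-base j) ⟩
  (s 0 j + shift (s 0) j) + (- 0ℚ) * s 0 j                                    ≡⟨ cancel (s 0 j) (shift (s 0) j) ⟩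
  s 0 j + shift (s 0) j                                                      ∎
  where
  open ≡-Reasoning
  base : ∀ j → translatedStirling 0 j ≡ s 0 j
  base zero    = refl
  base (suc j) = refl
  shift-base : ∀ j → shift (translatedStirling 0) j ≡ shift (s 0) j
  shift-base zero    = refl
  shift-base (suc j) = base j
  cancel : ∀ x y → (x + y) + (- 0ℚ) * x ≡ x + y
  cancel = solve 2 (λ x y → (x :+ y) :+ (:- con 0ℚ) :* x := x :+ y) refl
translatedStirling-suc (suc n) j = begin
  translatedStirling (2 ℕ.+ n) j
    ≡⟨ translatedStirling-rec (suc n) j ⟩
  (translatedStirling (suc n) j + shift (translatedStirling (suc n)) j) + (- ℕtoℚ (suc n)) * translatedStirling (suc n) j
    ≡⟨ cong₂ (λ u v → (u + v) + (- ℕtoℚ (suc n)) * u) (translatedStirling-suc n j) (shift-ih j) ⟩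
  ((s₀ + s₁) + (s₁ + s₂)) + (- ℕtoℚ (suc n)) * (s₀ + s₁)
    ≡⟨ cong (λ t → ((s₀ + s₁) + (s₁ + s₂)) + (- t) * (s₀ + s₁)) (ℕtoℚ-homo-+ 1 n) ⟩
  ((s₀ + s₁) + (s₁ + s₂)) + (- (1ℚ + ℕtoℚ n)) * (s₀ + s₁)
    ≡⟨ commute s₀ s₁ s₂ (ℕtoℚ n) ⟩
  (s₁ + (- ℕtoℚ n) * s₀) + (s₂ + (- ℕtoℚ n) * s₁)
    ≡⟨ cong₂ _+_ (s-suc n j) (shift-s-suc j) ⟨
  s (suc n) j + shift (s (suc n)) j
    ∎
  where
  open ≡-Reasoning
  s₀ = s n j
  s₁ = shift (s n) j
  s₂ = shift (shift (s n)) j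
  shift-ih : ∀ j → shift (translatedStirling (suc n)) j ≡ shift (s n) j + shift (shift (s n)) j
  shift-ih zero    = sym (ℚP.+-identityˡ 0ℚ)
  shift-ih (suc j) = translatedStirling-suc n j
  shift-s-suc : ∀ j → shift (s (suc n)) j ≡ shift (shift (s n)) j + (- ℕtoℚ n) * shift (s n) j
  shift-s-suc zero    = sym (trans (ℚP.+-identityˡ _) (ℚP.*-zeroʳ (- ℕtoℚ n)))
  shift-s-suc (suc j) = s-suc n j
  -- (X + 1 - (n + 1)) (1 + X) = (1 + X) (X - n), applied to sₙ
  commute : ∀ x y z t → ((x + y) + (y + z)) + (- (1ℚ + t)) * (x + y) ≡ (y + (- t) * x) + (z + (- t) * y)
  commute = solve 4 (λ x y z t →
    ((x :+ y) :+ (y :+ z)) :+ (:- (con 1ℚ :+ t)) :* (x :+ y) := (y :+ (:- t) :* x) :+ (z :+ (:- t) :* y)) refl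

translate-stirling : ∀ n j → translate (2 ℕ.+ n) (s (suc n)) j ≡ s (suc n) j + ℕtoℚ (suc n) * s n j
translate-stirling n j = begin
  translatedStirling (suc n) j                                   ≡⟨ translatedStirling-suc n j ⟩
  s n j + shift (s n) j                                          ≡⟨ regroup (s n j) (shift (s n) j) (ℕtoℚ n) ⟩
  (shift (s n) j + (- ℕtoℚ n) * s n j) + (1ℚ + ℕtoℚ n) * s n j  ≡⟨ cong₂ (λ u v → u + v * s n j) (s-suc n j) (ℕtoℚ-homo-+ 1 n) ⟨
  s (suc n) j + ℕtoℚ (suc n) * s n j                             ∎
  where
  open ≡-Reasoning
  regroup : ∀ x y t → x + y ≡ (y + (- t) * x) + (1ℚ + t) * x
  regroup = solve 3 (λ x y t → x :+ y := (y :+ (:- t) :* x) :+ (con 1ℚ :+ t) :* x) refl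

stirlingSum : (ℕ → ℚ) → ℕ → ℚ
stirlingSum G n = sumℚ (suc n) (λ k → G k * s n k)

sumℚ-*-twoIfOne : ∀ n (f : ℕ → ℚ) → sumℚ (2 ℕ.+ n) (λ k → f k * twoIfOne k) ≡ f 1 + f 1
sumℚ-*-twoIfOne n f = begin
  sumℚ (2 ℕ.+ n) g                      ≡⟨ sumℚ-suc-head (suc n) g ⟩
  g 0 + sumℚ (suc n) (g ∘ suc)          ≡⟨ cong (_+_ (g 0)) (sumℚ-suc-head n (g ∘ suc)) ⟩
  g 0 + (g 1 + sumℚ n (g ∘ suc ∘ suc))  ≡⟨ cong₂ (λ u v → u + (g 1 + v)) (ℚP.*-zeroʳ (f 0))
                                             (sumℚ-zero n (λ k _ → ℚP.*-zeroʳ (f (2 ℕ.+ k)))) ⟩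
  0ℚ + (f 1 * ℕtoℚ 2 + 0ℚ)              ≡⟨ double (f 1) ⟩
  f 1 + f 1                             ∎
  where
  open ≡-Reasoning
  g : ℕ → ℚ
  g k = f k * twoIfOne k
  double : ∀ x → 0ℚ + (x * ℕtoℚ 2 + 0ℚ) ≡ x + x
  double = solve 1 (λ x → con 0ℚ :+ (x :* con (ℕtoℚ 2) :+ con 0ℚ) := x :+ x) refl

binomialSum-extend : ∀ N {k} (g : ℕ → ℚ) → k < N →
  sumℚ (suc k) (λ j → ℕtoℚ (k C j) * g j) ≡ sumℚ N (λ j → ℕtoℚ (k C j) * g j)
binomialSum-extend N {k} g k<N = begin
  sumℚ (suc k) h                ≡⟨ sumℚ-extend (suc k) (N ∸ suc k) beyond-k ⟨
  sumℚ (N ∸ suc k ℕ.+ suc k) h  ≡⟨ cong (λ M → sumℚ M h) (ℕP.m∸n+n≡m k<N) ⟩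
  sumℚ N h                      ∎
  where
  open ≡-Reasoning
  h : ℕ → ℚ
  h j = ℕtoℚ (k C j) * g j
  beyond-k : ∀ j → suc k ≤ j → h j ≡ 0ℚ
  beyond-k j k<j = trans (cong (λ u → ℕtoℚ u * g j) (k>n⇒nCk≡0 k<j)) (ℚP.*-zeroˡ (g j))

sumℚ-*-binomialSum : ∀ N (f g : ℕ → ℚ) →
  sumℚ N (λ k → f k * sumℚ N (λ j → ℕtoℚ (k C j) * g j)) ≡ sumℚ N (λ j → g j * translate N f j)
sumℚ-*-binomialSum N f g = begin
  sumℚ N (λ k → f k * sumℚ N (λ j → ℕtoℚ (k C j) * g j))
    ≡⟨ sumℚ-cong N (λ k → sumℚ-*ˡ N (f k) (λ j → ℕtoℚ (k C j) * g j)) ⟨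
  sumℚ N (λ k → sumℚ N (λ j → f k * (ℕtoℚ (k C j) * g j)))
    ≡⟨ sumℚ-swap N N _ ⟩
  sumℚ N (λ j → sumℚ N (λ k → f k * (ℕtoℚ (k C j) * g j)))
    ≡⟨ sumℚ-cong N (λ j → sumℚ-cong N (λ k → rotate (f k) (ℕtoℚ (k C j)) (g j))) ⟩
  sumℚ N (λ j → sumℚ N (λ k → g j * (ℕtoℚ (k C j) * f k)))
    ≡⟨ sumℚ-cong N (λ j → sumℚ-*ˡ N (g j) (λ k → ℕtoℚ (k C j) * f k)) ⟩
  sumℚ N (λ j → g j * translate N f j)
    ∎
  where
  open ≡-Reasoning
  rotate : ∀ x y z → x * (y * z) ≡ z * (y * x)
  rotate = solve 3 (λ x y z → x :* (y :* z) := z :* (y :* x)) refl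

sumℚ-*-translate-stirling : ∀ (G : ℕ → ℚ) n →
  sumℚ (2 ℕ.+ n) (λ j → G j * translate (2 ℕ.+ n) (s (suc n)) j) ≡
  stirlingSum G (suc n) + ℕtoℚ (suc n) * stirlingSum G n
sumℚ-*-translate-stirling G n = begin
  sumℚ (2 ℕ.+ n) (λ j → G j * translate (2 ℕ.+ n) (s (suc n)) j)
    ≡⟨ sumℚ-cong (2 ℕ.+ n) (λ j → cong (G j *_) (translate-stirling n j)) ⟩
  sumℚ (2 ℕ.+ n) (λ j → G j * (s (suc n) j + ℕtoℚ (suc n) * s n j))
    ≡⟨ sumℚ-cong (2 ℕ.+ n) (λ j → distrib (G j) (s (suc n) j) (ℕtoℚ (suc n)) (s n j)) ⟩
  sumℚ (2 ℕ.+ n) (λ j → G j * s (suc n) j + ℕtoℚ (suc n) * (G j * s n j))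
    ≡⟨ sumℚ-+ (2 ℕ.+ n) (λ j → G j * s (suc n) j) (λ j → ℕtoℚ (suc n) * (G j * s n j)) ⟩
  stirlingSum G (suc n) + sumℚ (2 ℕ.+ n) (λ j → ℕtoℚ (suc n) * (G j * s n j))
    ≡⟨ cong (_+_ (stirlingSum G (suc n))) (sumℚ-*ˡ (2 ℕ.+ n) (ℕtoℚ (suc n)) (λ j → G j * s n j)) ⟩
  stirlingSum G (suc n) + ℕtoℚ (suc n) * sumℚ (2 ℕ.+ n) (λ j → G j * s n j)
    ≡⟨ cong (λ u → stirlingSum G (suc n) + ℕtoℚ (suc n) * u) drop-last ⟩
  stirlingSum G (suc n) + ℕtoℚ (suc n) * stirlingSum G n
    ∎
  where
  open ≡-Reasoning
  distrib : ∀ w x y z → w * (x + y * z) ≡ w * x + y * (w * z)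
  distrib = solve 4 (λ w x y z → w :* (x :+ y :* z) := w :* x :+ y :* (w :* z)) refl
  drop-last : sumℚ (2 ℕ.+ n) (λ j → G j * s n j) ≡ stirlingSum G n
  drop-last = sumℚ-suc-last-zero (suc n)
    (trans (cong (G (suc n) *_) (s-vanish {n} ℕP.≤-refl)) (ℚP.*-zeroʳ (G (suc n))))

signPred-suc : ∀ n → signPred (suc n) ≡ - signPred n
signPred-suc zero    = refl
signPred-suc (suc n) = begin
  ℤtoℚ (ℤ.-1ℤ ℤ.* ℤ.-1ℤ ℤ.^ n)  ≡⟨ ℤtoℚ-homo-* ℤ.-1ℤ (ℤ.-1ℤ ℤ.^ n) ⟩
  - 1ℚ * signPred (suc n)       ≡⟨ ℚP.neg-distribˡ-* 1ℚ (signPred (suc n)) ⟨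
  - (1ℚ * signPred (suc n))     ≡⟨ cong -_ (ℚP.*-identityˡ (signPred (suc n))) ⟩
  - signPred (suc n)            ∎
  where open ≡-Reasoning

signPred-*-s-suc-one : ∀ n → signPred (suc n) * s (suc n) 1 ≡ ℕtoℚ (n !)
signPred-*-s-suc-one zero    = refl
signPred-*-s-suc-one (suc n) = begin
  signPred (2 ℕ.+ n) * s (2 ℕ.+ n) 1           ≡⟨ cong₂ _*_ (signPred-suc (suc n)) (s-suc (suc n) 1) ⟩
  (- e) * (s (suc n) 0 + (- t) * s (suc n) 1)  ≡⟨ cong (λ u → (- e) * (u + (- t) * s (suc n) 1))
                                                     (cong ℤtoℚ (stirling1-suc-zero n)) ⟩
  (- e) * (0ℚ + (- t) * s (suc n) 1)           ≡⟨ reorder e t (s (suc n) 1) ⟩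
  t * (e * s (suc n) 1)                        ≡⟨ cong (t *_) (signPred-*-s-suc-one n) ⟩
  t * ℕtoℚ (n !)                               ≡⟨ ℕtoℚ-homo-* (suc n) (n !) ⟨
  ℕtoℚ (suc n !)                               ∎
  where
  open ≡-Reasoning
  e = signPred (suc n)
  t = ℕtoℚ (suc n)
  reorder : ∀ x y z → (- x) * (0ℚ + (- y) * z) ≡ y * (x * z)
  reorder = solve 3 (λ x y z → (:- x) :* (con 0ℚ :+ (:- y) :* z) := y :* (x :* z)) refl

module _ {G : ℕ → ℚ} (isGenocchi : IsGenocchi G) where

  genocchi-zero : G 0 ≡ 0ℚ
  genocchi-zero = double-injective (trans (sym (expand (G 0))) (isGenocchi 0))
    where
    expand : ∀ x → (0ℚ + 1ℚ * x) + x ≡ x + x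
    expand = solve 1 (λ x → (con 0ℚ :+ con 1ℚ :* x) :+ x := x :+ x) refl

  -- Pair the Genocchi relation for index k with s(n + 1, k) and sum over k.
  stirlingSum-rec : ∀ n →
    s (suc n) 1 + s (suc n) 1 ≡ (stirlingSum G (suc n) + ℕtoℚ (suc n) * stirlingSum G n) + stirlingSum G (suc n)
  stirlingSum-rec n = begin
    s m 1 + s m 1
      ≡⟨ sumℚ-*-twoIfOne n (s m) ⟨
    sumℚ N (λ k → s m k * twoIfOne k)
      ≡⟨ sumℚ-cong< N (λ k k<N → cong (s m k *_) (genocchi-relation k k<N)) ⟨
    sumℚ N (λ k → s m k * (binomialSum k + G k))
      ≡⟨ sumℚ-cong N (λ k → ℚP.*-distribˡ-+ (s m k) (binomialSum k) (G k)) ⟩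
    sumℚ N (λ k → s m k * binomialSum k + s m k * G k)
      ≡⟨ sumℚ-+ N (λ k → s m k * binomialSum k) (λ k → s m k * G k) ⟩
    sumℚ N (λ k → s m k * binomialSum k) + sumℚ N (λ k → s m k * G k)
      ≡⟨ cong₂ _+_ (sumℚ-*-binomialSum N (s m) G) (sumℚ-cong N (λ k → ℚP.*-comm (s m k) (G k))) ⟩
    sumℚ N (λ j → G j * translate N (s m) j) + stirlingSum G m
      ≡⟨ cong (_+ stirlingSum G m) (sumℚ-*-translate-stirling G n) ⟩
    (stirlingSum G m + ℕtoℚ m * stirlingSum G n) + stirlingSum G m
      ∎
    where
    open ≡-Reasoning
    m = suc n
    N = suc m
    binomialSum : ℕ → ℚ
    binomialSum k = sumℚ N (λ j → ℕtoℚ (k C j) * G j)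
    genocchi-relation : ∀ k → k < N → binomialSum k + G k ≡ twoIfOne k
    genocchi-relation k k<N = trans (cong (_+ G k) (sym (binomialSum-extend N G k<N))) (isGenocchi k)

  signedStirlingSum-rec : ∀ n →
    ℕtoℚ (suc n) * (signPred n * stirlingSum G n) + (ℕtoℚ (n !) + ℕtoℚ (n !)) ≡
    signPred (suc n) * stirlingSum G (suc n) + signPred (suc n) * stirlingSum G (suc n)
  signedStirlingSum-rec n = begin
    t * (e * c) + (ℕtoℚ (n !) + ℕtoℚ (n !))  ≡⟨ cong (λ v → t * (e * c) + (v + v)) (signPred-*-s-suc-one n) ⟨
    t * (e * c) + (e′ * σ + e′ * σ)          ≡⟨ cong (_+_ (t * (e * c))) (ℚP.*-distribˡ-+ e′ σ σ) ⟨
    t * (e * c) + e′ * (σ + σ)               ≡⟨ cong₂ (λ u v → t * (e * c) + u * v) (signPred-suc n) (stirlingSum-rec n) ⟩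
    t * (e * c) + (- e) * ((c′ + t * c) + c′) ≡⟨ cancel t e c c′ ⟩
    (- e) * c′ + (- e) * c′                  ≡⟨ cong (λ u → u * c′ + u * c′) (signPred-suc n) ⟨
    e′ * c′ + e′ * c′                        ∎
    where
    open ≡-Reasoning
    t = ℕtoℚ (suc n)
    e = signPred n
    e′ = signPred (suc n)
    c = stirlingSum G n
    c′ = stirlingSum G (suc n)
    σ = s (suc n) 1
    cancel : ∀ w x y z → w * (x * y) + (- x) * ((z + w * y) + z) ≡ (- x) * z + (- x) * z
    cancel = solve 4 (λ w x y z → w :* (x :* y) :+ (:- x) :* ((z :+ w :* y) :+ z) := (:- x) :* z :+ (:- x) :* z) refl

[1+k]!d!+k![1+d]!≡[2+k+d]k!d! : ∀ k d → suc k ! ℕ.* d ! ℕ.+ k ! ℕ.* suc d ! ≡ (2 ℕ.+ k ℕ.+ d) ℕ.* (k ! ℕ.* d !)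
[1+k]!d!+k![1+d]!≡[2+k+d]k!d! k d = factor k d (k !) (d !)
  where
  factor : ∀ k d x y → (suc k ℕ.* x) ℕ.* y ℕ.+ x ℕ.* (suc d ℕ.* y) ≡ (2 ℕ.+ k ℕ.+ d) ℕ.* (x ℕ.* y)
  factor = solve-∀

-- Add the two ways of splitting off an extreme term k = 0 or k = n + 1 from a(n + 2).
a-rec : ∀ n → ℕtoℚ (a (suc n)) + ℕtoℚ (a (suc n)) ≡ ℕtoℚ (suc n) * ℕtoℚ (a n) + (ℕtoℚ (n !) + ℕtoℚ (n !))
a-rec zero    = refl
a-rec (suc m) = begin
  ℕtoℚ (a (2 ℕ.+ m)) + ℕtoℚ (a (2 ℕ.+ m))
    ≡⟨ cong₂ _+_ (trans (ℕtoℚ-sumℕ (2 ℕ.+ m) _) (sumℚ-suc-head (suc m) g)) (ℕtoℚ-sumℕ (2 ℕ.+ m) _) ⟩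
  (g 0 + S₁) + (S₂ + g (suc m))
    ≡⟨ cong₂ (λ u v → (u + S₁) + (S₂ + v)) first last ⟩
  (F + S₁) + (S₂ + F)
    ≡⟨ regroup F S₁ S₂ ⟩
  (S₁ + S₂) + (F + F)
    ≡⟨ cong (_+ (F + F)) (sumℚ-+ (suc m) (g ∘ suc) g) ⟨
  sumℚ (suc m) (λ k → g (suc k) + g k) + (F + F)
    ≡⟨ cong (_+ (F + F)) (sumℚ-cong< (suc m) (λ k k<1+m → pointwise k (ℕP.≤-pred k<1+m))) ⟩
  sumℚ (suc m) (λ k → ℕtoℚ (2 ℕ.+ m) * h k) + (F + F)
    ≡⟨ cong (_+ (F + F)) (sumℚ-*ˡ (suc m) (ℕtoℚ (2 ℕ.+ m)) h) ⟩
  ℕtoℚ (2 ℕ.+ m) * sumℚ (suc m) h + (F + F)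
    ≡⟨ cong (λ u → ℕtoℚ (2 ℕ.+ m) * u + (F + F)) (ℕtoℚ-sumℕ (suc m) (λ k → k ! ℕ.* (m ∸ k) !)) ⟨
  ℕtoℚ (2 ℕ.+ m) * ℕtoℚ (a (suc m)) + (F + F)
    ∎
  where
  open ≡-Reasoning
  g h : ℕ → ℚ
  g k = ℕtoℚ (k ! ℕ.* (suc m ∸ k) !)
  h k = ℕtoℚ (k ! ℕ.* (m ∸ k) !)
  F = ℕtoℚ (suc m !)
  S₁ = sumℚ (suc m) (g ∘ suc)
  S₂ = sumℚ (suc m) g
  first : g 0 ≡ F
  first = cong ℕtoℚ (ℕP.*-identityˡ (suc m !))
  last : g (suc m) ≡ F
  last = cong ℕtoℚ (trans (cong (λ d → suc m ! ℕ.* d !) (ℕP.n∸n≡0 m)) (ℕP.*-identityʳ (suc m !)))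
  regroup : ∀ x y z → (x + y) + (z + x) ≡ (y + z) + (x + x)
  regroup = solve 3 (λ x y z → (x :+ y) :+ (z :+ x) := (y :+ z) :+ (x :+ x)) refl
  pointwise : ∀ k → k ≤ m → g (suc k) + g k ≡ ℕtoℚ (2 ℕ.+ m) * h k
  pointwise k k≤m = begin
    g (suc k) + g k
      ≡⟨ ℕtoℚ-homo-+ (suc k ! ℕ.* (m ∸ k) !) (k ! ℕ.* (suc m ∸ k) !) ⟨
    ℕtoℚ (suc k ! ℕ.* (m ∸ k) ! ℕ.+ k ! ℕ.* (suc m ∸ k) !)
      ≡⟨ cong (λ d → ℕtoℚ (suc k ! ℕ.* (m ∸ k) ! ℕ.+ k ! ℕ.* d !)) (ℕP.+-∸-assoc 1 k≤m) ⟩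
    ℕtoℚ (suc k ! ℕ.* (m ∸ k) ! ℕ.+ k ! ℕ.* suc (m ∸ k) !)
      ≡⟨ cong ℕtoℚ ([1+k]!d!+k![1+d]!≡[2+k+d]k!d! k (m ∸ k)) ⟩
    ℕtoℚ ((2 ℕ.+ k ℕ.+ (m ∸ k)) ℕ.* (k ! ℕ.* (m ∸ k) !))
      ≡⟨ cong (λ l → ℕtoℚ ((2 ℕ.+ l) ℕ.* (k ! ℕ.* (m ∸ k) !))) (ℕP.m+[n∸m]≡n k≤m) ⟩
    ℕtoℚ ((2 ℕ.+ m) ℕ.* (k ! ℕ.* (m ∸ k) !))
      ≡⟨ ℕtoℚ-homo-* (2 ℕ.+ m) (k ! ℕ.* (m ∸ k) !) ⟩
    ℕtoℚ (2 ℕ.+ m) * h k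
      ∎

corollary2 : (G : ℕ → ℚ) → IsGenocchi G → (n : ℕ) →
    ℕtoℚ (a n) ≡ signPred n * sumℚ (suc n) (λ k → G k * ℤtoℚ (stirling1 n k))
corollary2 G isGenocchi zero    = sym (cong (λ g → signPred 0 * (0ℚ + g * s 0 0)) (genocchi-zero isGenocchi))
corollary2 G isGenocchi (suc n) = double-injective (begin
  ℕtoℚ (a (suc n)) + ℕtoℚ (a (suc n))
    ≡⟨ a-rec n ⟩
  ℕtoℚ (suc n) * ℕtoℚ (a n) + (ℕtoℚ (n !) + ℕtoℚ (n !))
    ≡⟨ cong (λ u → ℕtoℚ (suc n) * u + (ℕtoℚ (n !) + ℕtoℚ (n !))) (corollary2 G isGenocchi n) ⟩
  ℕtoℚ (suc n) * (signPred n * stirlingSum G n) + (ℕtoℚ (n !) + ℕtoℚ (n !))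
    ≡⟨ signedStirlingSum-rec isGenocchi n ⟩
  signPred (suc n) * stirlingSum G (suc n) + signPred (suc n) * stirlingSum G (suc n)
    ∎)
  where open ≡-Reasoning
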